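{- Let $G=(V,E)$ be a graph, $c:V\to\mathbb{N}$, $\epsilon>0$ and $\alpha\ge 1$. Let $E'$ be a maximal solution of IP2 which is $\alpha$-approximate, i.e., $\phi(E')\ge \mathrm{OPT}_{IP2}/\alpha$ where $\mathrm{OPT}_{IP2}$ is the optimal value of IP2. Then $E'$ is a $2\alpha/(1-\epsilon)$ approximation of PDBEP: $E'$ is a feasible PDBEP solution and $(1-\epsilon)|E''|\le 2\alpha|E'|$ for every optimal PDBEP solution $E''$.
   Context: PDBEP: given $G=(V,E)$ and $c:V\to\mathbb{N}$, $E'\subseteq E$ is feasible if for every $(u,v)\in E'$, $d'_u\le c_u$ or $d'_v\le c_v$, with $d'_x$ the degree of $x$ in $(V,E')$; one maximizes $|E'|$. IP2 (for fixed $\epsilon>0$): maximize $\phi=2\sum_{e\in E}y_e-(1+\epsilon)\sum_{v\in V}z_v$ subject to $\sum_{e\in\delta(v)}y_e\le c_v+z_v$ for all $v$, $z_v\in\{0,1,2,\dots\}$, $y_e\in\{0,1\}$, where $\delta(v)$ is the set of edges incident on $v$. A solution is identified with $E'=\{e:y_e=1\}$, and for an edge set its $\phi$-value is computed with $z_v=\max\{0,\sum_{e\in\delta(v)}y_e-c_v\}$. A maximal solution of IP2 is one with $z_v=\max\{0,\sum_{e\in\delta(v)}y_e-c_v\}$ for all $v$ such that deleting an edge of $E'$ or adding an edge of $E\setminus E'$ (with $z$ recomputed) does not improve the objective value.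
   Formalization: The parameters ε and α range over the rationals. -}

module Defs where

open import Data.Nat as ℕ using (ℕ; _∸_)
open import Data.Integer using (+_)
open import Data.Rational using (ℚ; _+_; _-_; _*_; 1ℚ) renaming (_/_ to _//_)
open import Data.Fin using (Fin; _≟_)
open import Data.Fin.Subset using (Subset; inside; outside; _∩_; _∈_; ∣_∣)
open import Data.Vec using (tabulate)
open import Data.List using (allFin; map)
open import Data.Nat.ListAction using (sum)
open import Data.Bool using (if_then_else_; _∨_)
open import Data.Product using (_×_; proj₁; proj₂)
open import Data.Sum using (_⊎_)
open import Relation.Binary.PropositionalEquality using (_≡_; _≢_)
open import Relation.Nullary.Decidable using (⌊_⌋)

record SimpleGraph (n m : ℕ) : Set where
  field
    ends   : Fin m → Fin n × Fin n
    noLoop : ∀ e → proj₁ (ends e) ≢ proj₂ (ends e)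
    simple : ∀ e f →
             (proj₁ (ends e) ≡ proj₁ (ends f) × proj₂ (ends e) ≡ proj₂ (ends f)) ⊎
             (proj₁ (ends e) ≡ proj₂ (ends f) × proj₂ (ends e) ≡ proj₁ (ends f)) →
             e ≡ f
open SimpleGraph public

ℕtoℚ : ℕ → ℚ
ℕtoℚ k = (+ k) // 1

module _ {n m : ℕ} (G : SimpleGraph n m) where

  δ : Fin n → Subset m
  δ v = tabulate (λ e → if ⌊ v ≟ proj₁ (ends G e) ⌋ ∨ ⌊ v ≟ proj₂ (ends G e) ⌋
                         then inside else outside)

  deg : Subset m → Fin n → ℕ
  deg S v = ∣ S ∩ δ v ∣

  PDBEP-Feasible : (c : Fin n → ℕ) → Subset m → Set
  PDBEP-Feasible c S = ∀ e → e ∈ S →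
    (deg S (proj₁ (ends G e)) ℕ.≤ c (proj₁ (ends G e))) ⊎
    (deg S (proj₂ (ends G e)) ℕ.≤ c (proj₂ (ends G e)))

  PDBEP-Optimal : (c : Fin n → ℕ) → Subset m → Set
  PDBEP-Optimal c S = PDBEP-Feasible c S × (∀ F → PDBEP-Feasible c F → ∣ F ∣ ℕ.≤ ∣ S ∣)

  sumV : (Fin n → ℕ) → ℕ
  sumV f = sum (map f (allFin n))

  -- feasibility of (y, z) for IP2 (y is given as the edge set {e : y_e = 1})
  IP2-Feasible : (c : Fin n → ℕ) → Subset m → (Fin n → ℕ) → Set
  IP2-Feasible c S z = ∀ v → deg S v ℕ.≤ c v ℕ.+ z v

  φyz : (ε : ℚ) → Subset m → (Fin n → ℕ) → ℚ
  φyz ε S z = ℕtoℚ 2 * ℕtoℚ ∣ S ∣ - (1ℚ + ε) * ℕtoℚ (sumV z)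

  zOf : (c : Fin n → ℕ) → Subset m → Fin n → ℕ
  zOf c S v = deg S v ∸ c v

  φ : (c : Fin n → ℕ) (ε : ℚ) → Subset m → ℚ
  φ c ε S = φyz ε S (zOf c S)

module Submission where

-- Write z_v(S) = max(0, deg_S(v) - c_v) for the excess of v and
-- φ(S) = 2|S| - (1+ε)·Σ_v z_v(S) for the IP2 objective of an edge set S.
--
-- If an edge e ∈ E′ had both endpoints above capacity,
-- deleting it would lower |E′| by 1 and the excess of each endpoint by 1,
-- so φ would grow by 2ε > 0, contradicting maximality of E′.
--
-- Double counting gives Σ_v a_v·deg_F(v) = Σ_{e ∈ F} (a_u + a_w)
-- for any vertex weights a.  Taking a = indicator of overloaded vertices and
-- using that a feasible F has at most one overloaded endpoint per edge yields
-- Σ_v z_v(F) ≤ |F|, hence (1-ε)|F| ≤ φ(F).  Since also φ(E′) ≤ 2|E′|,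
--   (1-ε)|E″| ≤ φ(E″) ≤ OPT_IP2 ≤ α·φ(E′) ≤ 2α·|E′|.

open import Defs
open import Data.Nat using (ℕ)
open import Data.Rational using (ℚ; 0ℚ; 1ℚ; _≤_; _<_; _*_; _-_)
open import Data.Fin using (Fin)
import Data.Fin.Subset
open import Data.Fin.Subset using (Subset; _∈_; _∉_; _∪_; ⁅_⁆; ∣_∣)
open import Data.Product using (_×_)

import Data.Nat as Nat
open Nat using (zero; suc; z≤n; s≤s)
import Data.Nat.Properties as ℕP
import Data.Integer as ℤ
import Data.Integer.Properties as ℤP
import Data.Rational as ℚ
import Data.Rational.Properties as ℚP
open import Data.Nat.Coprimality using (1-coprimeTo)
import Data.Nat.Coprimality as Coprime
open import Data.Fin using (zero; suc; _≟_)
open import Data.Fin.Subset using (_∩_; ⊤) renaming (_-_ to _∖_)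
open import Data.Fin.Subset.Properties using (∩-identityʳ; p─⊥≡p)
open import Data.Vec using ([]; _∷_; lookup; here; there)
open import Data.Vec.Properties using (lookup∘tabulate; lookup-replicate; lookup⇒[]=)
import Data.List as List
open import Data.List.Properties using (map-tabulate)
import Data.Nat.ListAction as ListAction
open import Data.Bool using (Bool; true; false; _∨_; if_then_else_)
open import Data.Product using (_,_; proj₁; proj₂)
open import Data.Sum using (_⊎_; inj₁; inj₂; [_,_])
import Data.Sum
open import Data.Empty using (⊥-elim)
open import Function using (id; _∘_)
open import Relation.Nullary using (does)
open import Relation.Nullary.Decidable using (yes; no; ⌊_⌋; isYes≗does)
open import Relation.Nullary.Reflects using (ofʸ; ofⁿ)
open import Relation.Binary.PropositionalEquality
  using (_≡_; refl; sym; trans; cong; cong₂; subst; subst₂; module ≡-Reasoning)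
open import Algebra.Properties.Semiring.Sum ℕP.+-*-semiring
  using (sum; sum-syntax; sum-cong-≗; sum-replicate-zero; ∑-distrib-+; ∑-comm; *-distribˡ-sum)
open import Algebra.Properties.CommutativeSemigroup ℕP.*-commutativeSemigroup
  using (x∙yz≈y∙xz)
open import Algebra.Bundles using (CommutativeMonoid)
open import Algebra.Properties.CommutativeSemigroup
  (CommutativeMonoid.commutativeSemigroup ℚP.*-1-commutativeMonoid) using (x∙yz≈yx∙z)
open import Tactic.RingSolver using (solve-∀)
open import Tactic.RingSolver.Core.AlmostCommutativeRing using (AlmostCommutativeRing; fromCommutativeRing)
open import Data.Maybe using (Maybe; just; nothing)

𝟙 : Bool → ℕ
𝟙 true  = 1
𝟙 false = 0

𝟙≤1 : ∀ b → 𝟙 b Nat.≤ 1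
𝟙≤1 true  = s≤s z≤n
𝟙≤1 false = z≤n

∑-mono-≤ : ∀ {k} {f g : Fin k → ℕ} → (∀ i → f i Nat.≤ g i) → sum f Nat.≤ sum g
∑-mono-≤ {zero}  f≤g = z≤n
∑-mono-≤ {suc k} f≤g = ℕP.+-mono-≤ (f≤g zero) (∑-mono-≤ (f≤g ∘ suc))

∑-select : ∀ {k} (g : Fin k → ℕ) (u : Fin k) → ∑[ v < k ] (g v Nat.* 𝟙 (does (v ≟ u))) ≡ g u
∑-select {suc k} g zero = begin
  g zero Nat.* 1 Nat.+ ∑[ v < k ] (g (suc v) Nat.* 0)
    ≡⟨ cong₂ Nat._+_ (ℕP.*-identityʳ _) (trans (sum-cong-≗ (ℕP.*-zeroʳ ∘ g ∘ suc)) (sum-replicate-zero k)) ⟩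
  g zero Nat.+ 0
    ≡⟨ ℕP.+-identityʳ _ ⟩
  g zero ∎
  where open ≡-Reasoning
∑-select {suc k} g (suc u) =
  cong₂ Nat._+_ (ℕP.*-zeroʳ (g zero)) (∑-select (g ∘ suc) u)

listSum-tabulate : ∀ {k} (f : Fin k → ℕ) → ListAction.sum (List.tabulate f) ≡ sum f
listSum-tabulate {zero}  f = refl
listSum-tabulate {suc k} f = cong (f zero Nat.+_) (listSum-tabulate (f ∘ suc))

sumV≡∑ : ∀ {n m} (G : SimpleGraph n m) (f : Fin n → ℕ) → sumV G f ≡ sum f
sumV≡∑ G f = trans (cong ListAction.sum (map-tabulate id f)) (listSum-tabulate f)

∣∣≡∑ : ∀ {k} (p : Subset k) → ∣ p ∣ ≡ ∑[ i < k ] 𝟙 (lookup p i)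
∣∣≡∑ []          = refl
∣∣≡∑ (true  ∷ p) = cong suc (∣∣≡∑ p)
∣∣≡∑ (false ∷ p) = ∣∣≡∑ p

∣∩∣≡∑ : ∀ {k} (p q : Subset k) → ∣ p ∩ q ∣ ≡ ∑[ i < k ] (𝟙 (lookup p i) Nat.* 𝟙 (lookup q i))
∣∩∣≡∑ []          []          = refl
∣∩∣≡∑ (true  ∷ p) (true  ∷ q) = cong suc (∣∩∣≡∑ p q)
∣∩∣≡∑ (true  ∷ p) (false ∷ q) = ∣∩∣≡∑ p q
∣∩∣≡∑ (false ∷ p) (_     ∷ q) = ∣∩∣≡∑ p q

-- Deleting a member x of p loses exactly the contribution of x to ∣ p ∩ q ∣.
-- At x itself p ∖ x continues as p ─ ⊥, which is p.
∩-remove : ∀ {k} {p : Subset k} {x} (q : Subset k) → x ∈ p →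
           ∣ p ∩ q ∣ ≡ 𝟙 (lookup q x) Nat.+ ∣ (p ∖ x) ∩ q ∣
∩-remove {p = _ ∷ p} (true  ∷ q) here = cong (λ r → suc ∣ r ∩ q ∣) (sym (p─⊥≡p p))
∩-remove {p = _ ∷ p} (false ∷ q) here = cong (λ r → ∣ r ∩ q ∣) (sym (p─⊥≡p p))
∩-remove {p = true  ∷ p} (true  ∷ q) (there x∈p) =
  trans (cong suc (∩-remove q x∈p)) (sym (ℕP.+-suc _ _))
∩-remove {p = true  ∷ p} (false ∷ q) (there x∈p) = ∩-remove q x∈p
∩-remove {p = false ∷ p} (_     ∷ q) (there x∈p) = ∩-remove q x∈p

∣-remove∣ : ∀ {k} {p : Subset k} {x} → x ∈ p → ∣ p ∣ ≡ suc ∣ p ∖ x ∣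
∣-remove∣ {p = p} {x} x∈p = begin
  ∣ p ∣                               ≡⟨ cong ∣_∣ (sym (∩-identityʳ p)) ⟩
  ∣ p ∩ ⊤ ∣                           ≡⟨ ∩-remove ⊤ x∈p ⟩
  𝟙 (lookup ⊤ x) Nat.+ ∣ (p ∖ x) ∩ ⊤ ∣ ≡⟨ cong₂ Nat._+_ (cong 𝟙 (lookup-replicate x true))
                                                       (cong ∣_∣ (∩-identityʳ (p ∖ x))) ⟩
  suc ∣ p ∖ x ∣                       ∎
  where open ≡-Reasoning

module Incidence {n m : ℕ} (G : SimpleGraph n m) where

  end₁ end₂ : Fin m → Fin n
  end₁ e = proj₁ (ends G e)
  end₂ e = proj₂ (ends G e)

  incident : Fin n → Fin m → Bool
  incident v e = does (v ≟ end₁ e) ∨ does (v ≟ end₂ e)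

  lookup-δ : ∀ v e → lookup (δ G v) e ≡ incident v e
  lookup-δ v e = begin
    lookup (δ G v) e                                       ≡⟨ lookup∘tabulate _ e ⟩
    (if isYes₁ ∨ isYes₂ then true else false)              ≡⟨ if-true-false (isYes₁ ∨ isYes₂) ⟩
    isYes₁ ∨ isYes₂                                        ≡⟨ cong₂ _∨_ (isYes≗does (v ≟ end₁ e))
                                                                          (isYes≗does (v ≟ end₂ e)) ⟩
    incident v e                                           ∎
    where
    open ≡-Reasoning
    isYes₁ = ⌊ v ≟ end₁ e ⌋
    isYes₂ = ⌊ v ≟ end₂ e ⌋
    if-true-false : ∀ b → (if b then true else false) ≡ b
    if-true-false true  = refl
    if-true-false false = refl

  -- Since e is not a loop, incidence splits into the two endpoint indicators.
  𝟙-incident : ∀ v e → 𝟙 (incident v e) ≡ 𝟙 (does (v ≟ end₁ e)) Nat.+ 𝟙 (does (v ≟ end₂ e))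
  𝟙-incident v e with v ≟ end₁ e | v ≟ end₂ e
  ... | yes v≡u | yes v≡w = ⊥-elim (noLoop G e (trans (sym v≡u) v≡w))
  ... | yes _   | no _    = refl
  ... | no _    | yes _   = refl
  ... | no _    | no _    = refl

  incident⇒endpoint : ∀ {v e} → incident v e ≡ true → v ≡ end₁ e ⊎ v ≡ end₂ e
  incident⇒endpoint {v} {e} _  with v ≟ end₁ e | v ≟ end₂ e
  incident⇒endpoint         _  | yes v≡u | _       = inj₁ v≡u
  incident⇒endpoint         _  | no _    | yes v≡w = inj₂ v≡w
  incident⇒endpoint         () | no _    | no _

  ∑-incident : ∀ (a : Fin n → ℕ) e →
    ∑[ v < n ] (a v Nat.* 𝟙 (incident v e)) ≡ a (end₁ e) Nat.+ a (end₂ e)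
  ∑-incident a e = begin
    ∑[ v < n ] (a v Nat.* 𝟙 (incident v e))
      ≡⟨ sum-cong-≗ {n} (λ v → trans (cong (a v Nat.*_) (𝟙-incident v e))
                                      (ℕP.*-distribˡ-+ (a v) _ _)) ⟩
    ∑[ v < n ] (a v Nat.* 𝟙 (does (v ≟ end₁ e)) Nat.+ a v Nat.* 𝟙 (does (v ≟ end₂ e)))
      ≡⟨ ∑-distrib-+ {n} (λ v → a v Nat.* 𝟙 (does (v ≟ end₁ e)))
                         (λ v → a v Nat.* 𝟙 (does (v ≟ end₂ e))) ⟩
    ∑[ v < n ] (a v Nat.* 𝟙 (does (v ≟ end₁ e)))
      Nat.+ ∑[ v < n ] (a v Nat.* 𝟙 (does (v ≟ end₂ e)))
      ≡⟨ cong₂ Nat._+_ (∑-select a (end₁ e)) (∑-select a (end₂ e)) ⟩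
    a (end₁ e) Nat.+ a (end₂ e) ∎
    where open ≡-Reasoning

  ∑-endpoints : ∀ e → ∑[ v < n ] 𝟙 (incident v e) ≡ 2
  ∑-endpoints e = trans (sum-cong-≗ {n} (λ v → sym (ℕP.*-identityˡ _))) (∑-incident (λ _ → 1) e)

  deg≡∑ : ∀ S v → deg G S v ≡ ∑[ e < m ] (𝟙 (lookup S e) Nat.* 𝟙 (incident v e))
  deg≡∑ S v = trans (∣∩∣≡∑ S (δ G v))
    (sum-cong-≗ (λ e → cong (λ b → 𝟙 (lookup S e) Nat.* 𝟙 b) (lookup-δ v e)))

  deg-remove : ∀ {S x} v → x ∈ S → deg G S v ≡ 𝟙 (incident v x) Nat.+ deg G (S ∖ x) v
  deg-remove {S} {x} v x∈S =
    trans (∩-remove (δ G v) x∈S) (cong (λ b → 𝟙 b Nat.+ deg G (S ∖ x) v) (lookup-δ v x))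

  ∑-weighted-degree : ∀ (a : Fin n → ℕ) S →
    ∑[ v < n ] (a v Nat.* deg G S v) ≡ ∑[ e < m ] (𝟙 (lookup S e) Nat.* (a (end₁ e) Nat.+ a (end₂ e)))
  ∑-weighted-degree a S = begin
    ∑[ v < n ] (a v Nat.* deg G S v)
      ≡⟨ sum-cong-≗ {n} (λ v → trans (cong (a v Nat.*_) (deg≡∑ S v))
                                      (*-distribˡ-sum {m} (a v) (λ e → s e Nat.* i v e))) ⟩
    ∑[ v < n ] ∑[ e < m ] (a v Nat.* (s e Nat.* i v e))
      ≡⟨ ∑-comm {n} {m} (λ v e → a v Nat.* (s e Nat.* i v e)) ⟩
    ∑[ e < m ] ∑[ v < n ] (a v Nat.* (s e Nat.* i v e))
      ≡⟨ sum-cong-≗ {m} (λ e → trans (sum-cong-≗ {n} (λ v → x∙yz≈y∙xz (a v) (s e) (i v e)))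
                                      (sym (*-distribˡ-sum {n} (s e) (λ v → a v Nat.* i v e)))) ⟩
    ∑[ e < m ] (s e Nat.* ∑[ v < n ] (a v Nat.* i v e))
      ≡⟨ sum-cong-≗ {m} (λ e → cong (s e Nat.*_) (∑-incident a e)) ⟩
    ∑[ e < m ] (s e Nat.* (a (end₁ e) Nat.+ a (end₂ e))) ∎
    where
    open ≡-Reasoning
    s : Fin m → ℕ
    s e = 𝟙 (lookup S e)
    i : Fin n → Fin m → ℕ
    i v e = 𝟙 (incident v e)

excess≤ : ∀ d c → d Nat.∸ c Nat.≤ 𝟙 (c Nat.<ᵇ d) Nat.* d
excess≤ d c with c Nat.<ᵇ d | ℕP.<ᵇ-reflects-< c d
... | true  | ofʸ _    = ℕP.≤-trans (ℕP.m∸n≤m d c) (ℕP.≤-reflexive (sym (ℕP.*-identityˡ d)))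
... | false | ofⁿ c≮d = ℕP.≤-reflexive (ℕP.m≤n⇒m∸n≡0 (ℕP.≮⇒≥ c≮d))

𝟙<ᵇ≡0 : ∀ {d c} → d Nat.≤ c → 𝟙 (c Nat.<ᵇ d) ≡ 0
𝟙<ᵇ≡0 {d} {c} d≤c with c Nat.<ᵇ d | ℕP.<ᵇ-reflects-< c d
... | true  | ofʸ c<d = ⊥-elim (ℕP.≤⇒≯ d≤c c<d)
... | false | ofⁿ _   = refl

excess-step : ∀ d c b → (b ≡ true → c Nat.< 𝟙 b Nat.+ d) →
              (𝟙 b Nat.+ d) Nat.∸ c ≡ 𝟙 b Nat.+ (d Nat.∸ c)
excess-step d c false _     = refl
excess-step d c true  c<1+d = ℕP.+-∸-assoc 1 (ℕP.m<1+n⇒m≤n (c<1+d refl))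

at-most-one : ∀ a b → a ≡ 0 ⊎ b ≡ 0 → a Nat.≤ 1 → b Nat.≤ 1 → a Nat.+ b Nat.≤ 1
at-most-one a b (inj₁ refl) _   b≤1 = b≤1
at-most-one a b (inj₂ refl) a≤1 _   = ℕP.≤-trans (ℕP.≤-reflexive (ℕP.+-identityʳ a)) a≤1

module Excess {n m : ℕ} (G : SimpleGraph n m) (c : Fin n → ℕ) where
  open Incidence G

  overloaded : Subset m → Fin n → ℕ
  overloaded S v = 𝟙 (c v Nat.<ᵇ deg G S v)

  feasible⇒one-overloaded-end : ∀ {F} → PDBEP-Feasible G c F → ∀ e →
    𝟙 (lookup F e) Nat.* (overloaded F (end₁ e) Nat.+ overloaded F (end₂ e)) Nat.≤ 𝟙 (lookup F e)
  feasible⇒one-overloaded-end {F} feasible e with lookup F e in e∈F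
  ... | false = z≤n
  ... | true  = ℕP.≤-trans (ℕP.≤-reflexive (ℕP.*-identityˡ _))
      (at-most-one _ _ (Data.Sum.map 𝟙<ᵇ≡0 𝟙<ᵇ≡0 (feasible e (lookup⇒[]= e F e∈F))) (𝟙≤1 _) (𝟙≤1 _))

  -- A PDBEP-feasible edge set has total excess at most its size: charge the
  -- excess of an overloaded vertex to its edges, each edge being charged once.
  ∑excess≤card : ∀ {F} → PDBEP-Feasible G c F → sumV G (zOf G c F) Nat.≤ ∣ F ∣
  ∑excess≤card {F} feasible = begin
    sumV G (zOf G c F)
      ≡⟨ sumV≡∑ G (zOf G c F) ⟩
    ∑[ v < n ] zOf G c F v
      ≤⟨ ∑-mono-≤ (λ v → excess≤ (deg G F v) (c v)) ⟩
    ∑[ v < n ] (overloaded F v Nat.* deg G F v)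
      ≡⟨ ∑-weighted-degree (overloaded F) F ⟩
    ∑[ e < m ] (𝟙 (lookup F e) Nat.* (overloaded F (end₁ e) Nat.+ overloaded F (end₂ e)))
      ≤⟨ ∑-mono-≤ (feasible⇒one-overloaded-end feasible) ⟩
    ∑[ e < m ] 𝟙 (lookup F e)
      ≡⟨ sym (∣∣≡∑ F) ⟩
    ∣ F ∣ ∎
    where open ℕP.≤-Reasoning

  excess-IP2-feasible : ∀ S → IP2-Feasible G c S (zOf G c S)
  excess-IP2-feasible S v = ℕP.m≤n+m∸n (deg G S v) (c v)

  ∑excess-remove : ∀ {S e} → e ∈ S →
    c (end₁ e) Nat.< deg G S (end₁ e) → c (end₂ e) Nat.< deg G S (end₂ e) →
    sumV G (zOf G c S) ≡ 2 Nat.+ sumV G (zOf G c (S ∖ e))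
  ∑excess-remove {S} {e} e∈S over₁ over₂ = begin
    sumV G (zOf G c S)
      ≡⟨ sumV≡∑ G (zOf G c S) ⟩
    ∑[ v < n ] zOf G c S v
      ≡⟨ sum-cong-≗ {n} excess-remove ⟩
    ∑[ v < n ] (𝟙 (incident v e) Nat.+ zOf G c (S ∖ e) v)
      ≡⟨ ∑-distrib-+ {n} (λ v → 𝟙 (incident v e)) (zOf G c (S ∖ e)) ⟩
    ∑[ v < n ] 𝟙 (incident v e) Nat.+ ∑[ v < n ] zOf G c (S ∖ e) v
      ≡⟨ cong₂ Nat._+_ (∑-endpoints e) (sym (sumV≡∑ G (zOf G c (S ∖ e)))) ⟩
    2 Nat.+ sumV G (zOf G c (S ∖ e)) ∎
    where
    open ≡-Reasoning
    endpoint-overloaded : ∀ {v} → v ≡ end₁ e ⊎ v ≡ end₂ e → c v Nat.< deg G S v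
    endpoint-overloaded = [ (λ v≡u → subst (λ x → c x Nat.< deg G S x) (sym v≡u) over₁)
                          , (λ v≡w → subst (λ x → c x Nat.< deg G S x) (sym v≡w) over₂) ]
    excess-remove : ∀ v → zOf G c S v ≡ 𝟙 (incident v e) Nat.+ zOf G c (S ∖ e) v
    excess-remove v = trans (cong (Nat._∸ c v) (deg-remove v e∈S))
      (excess-step (deg G (S ∖ e) v) (c v) (incident v e)
        (λ inc → subst (c v Nat.<_) (deg-remove v e∈S) (endpoint-overloaded (incident⇒endpoint inc))))

ℕtoℚ≡mkℚ : ∀ k → ℕtoℚ k ≡ ℚ.mkℚ (ℤ.+ k) 0 (Coprime.sym (1-coprimeTo k))
ℕtoℚ≡mkℚ k = ℚP.↥p/↧p≡p (ℚ.mkℚ (ℤ.+ k) 0 (Coprime.sym (1-coprimeTo k)))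

ℕtoℚ-+ : ∀ a b → ℕtoℚ (a Nat.+ b) ≡ ℕtoℚ a ℚ.+ ℕtoℚ b
ℕtoℚ-+ a b =
  trans (cong (ℚ._/ 1) (sym numerators)) (sym (cong₂ ℚ._+_ (ℕtoℚ≡mkℚ a) (ℕtoℚ≡mkℚ b)))
  where
  numerators : ℤ.+ a ℤ.* ℤ.+ 1 ℤ.+ ℤ.+ b ℤ.* ℤ.+ 1 ≡ ℤ.+ (a Nat.+ b)
  numerators = trans (cong₂ ℤ._+_ (ℤP.*-identityʳ (ℤ.+ a)) (ℤP.*-identityʳ (ℤ.+ b))) (sym (ℤP.pos-+ a b))

ℕtoℚ-mono : ∀ {a b} → a Nat.≤ b → ℕtoℚ a ≤ ℕtoℚ b
ℕtoℚ-mono {a} {b} a≤b rewrite ℕtoℚ≡mkℚ a | ℕtoℚ≡mkℚ b =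
  ℚ.*≤* (subst₂ ℤ._≤_ (sym (ℤP.*-identityʳ (ℤ.+ a))) (sym (ℤP.*-identityʳ (ℤ.+ b))) (ℤ.+≤+ a≤b))

-- Rational facts about the IP2 objective 2a - (1+ε)z, with a = |y| and z = Σ z_v;
-- by definition φyz G ε S z is this expression at a = |S|, z = sumV G z.
-- The objective decreases in z for ε ≥ 0.
objective-antitone : ∀ {ε} a {z z′} → 0ℚ ≤ ε → z ≤ z′ →
  ℕtoℚ 2 * a - (1ℚ ℚ.+ ε) * z′ ≤ ℕtoℚ 2 * a - (1ℚ ℚ.+ ε) * z
objective-antitone {ε} a ε≥0 z≤z′ =
  ℚP.+-monoʳ-≤ (ℕtoℚ 2 * a) (ℚP.neg-antimono-≤ (ℚP.*-monoˡ-≤-nonNeg (1ℚ ℚ.+ ε) z≤z′))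
  where
  instance
    1+ε≥0 : ℚ.NonNegative (1ℚ ℚ.+ ε)
    1+ε≥0 = ℚ.nonNegative (ℚP.+-mono-≤ (ℚP.nonNegative⁻¹ 1ℚ) ε≥0)

ℚ-ring : AlmostCommutativeRing _ _
ℚ-ring = fromCommutativeRing ℚP.+-*-commutativeRing isZero
  where
  isZero : ∀ x → Maybe (0ℚ ≡ x)
  isZero x with 0ℚ ℚP.≟ x
  ... | yes 0≡x = just 0≡x
  ... | no _    = nothing

objective-at-size : ∀ ε a → ℕtoℚ 2 * a - (1ℚ ℚ.+ ε) * a ≡ (1ℚ - ε) * a
objective-at-size = solve-∀ ℚ-ring

objective-at-0 : ∀ ε a → ℕtoℚ 2 * a - (1ℚ ℚ.+ ε) * 0ℚ ≡ ℕtoℚ 2 * a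
objective-at-0 = solve-∀ ℚ-ring

-- One more unit of y paid for by two more units of z costs 2ε.
objective-shift : ∀ ε a z →
  (ℕtoℚ 2 * (1ℚ ℚ.+ a) - (1ℚ ℚ.+ ε) * (ℕtoℚ 2 ℚ.+ z)) ℚ.+ (ε ℚ.+ ε)
    ≡ ℕtoℚ 2 * a - (1ℚ ℚ.+ ε) * z
objective-shift = solve-∀ ℚ-ring

module Objective {n m : ℕ} (G : SimpleGraph n m) (c : Fin n → ℕ) (ε : ℚ) where
  open Incidence G
  open Excess G c

  φ≤2∣S∣ : 0ℚ ≤ ε → ∀ S → φ G c ε S ≤ ℕtoℚ 2 * ℕtoℚ ∣ S ∣
  φ≤2∣S∣ ε≥0 S = subst (φ G c ε S ≤_) (objective-at-0 ε (ℕtoℚ ∣ S ∣))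
    (objective-antitone (ℕtoℚ ∣ S ∣) ε≥0 (ℕtoℚ-mono {0} {sumV G (zOf G c S)} z≤n))

  feasible⇒φ≥ : 0ℚ ≤ ε → ∀ {F} → PDBEP-Feasible G c F → (1ℚ - ε) * ℕtoℚ ∣ F ∣ ≤ φ G c ε F
  feasible⇒φ≥ ε≥0 {F} feasible = subst (_≤ φ G c ε F) (objective-at-size ε (ℕtoℚ ∣ F ∣))
    (objective-antitone (ℕtoℚ ∣ F ∣) ε≥0 (ℕtoℚ-mono (∑excess≤card feasible)))

  φ-remove : 0ℚ < ε → ∀ {S e} → e ∈ S →
    c (end₁ e) Nat.< deg G S (end₁ e) → c (end₂ e) Nat.< deg G S (end₂ e) →
    φ G c ε S < φ G c ε (S ∖ e)
  φ-remove ε>0 {S} {e} e∈S over₁ over₂ =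
    subst₂ _<_ (ℚP.+-identityʳ (φ G c ε S)) φS+2ε≡φS∖e
      (ℚP.+-monoʳ-< (φ G c ε S) (ℚP.+-mono-< ε>0 ε>0))
    where
    a z : ℚ
    a = ℕtoℚ ∣ S ∖ e ∣
    z = ℕtoℚ (sumV G (zOf G c (S ∖ e)))
    φS≡ : φ G c ε S ≡ ℕtoℚ 2 * (1ℚ ℚ.+ a) - (1ℚ ℚ.+ ε) * (ℕtoℚ 2 ℚ.+ z)
    φS≡ = cong₂ (λ a′ z′ → ℕtoℚ 2 * a′ - (1ℚ ℚ.+ ε) * z′)
      (trans (cong ℕtoℚ (∣-remove∣ e∈S)) (ℕtoℚ-+ 1 ∣ S ∖ e ∣))
      (trans (cong ℕtoℚ (∑excess-remove e∈S over₁ over₂)) (ℕtoℚ-+ 2 (sumV G (zOf G c (S ∖ e)))))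
    φS+2ε≡φS∖e : φ G c ε S ℚ.+ (ε ℚ.+ ε) ≡ φ G c ε (S ∖ e)
    φS+2ε≡φS∖e = trans (cong (ℚ._+ (ε ℚ.+ ε)) φS≡) (objective-shift ε a z)

  -- A set that cannot be improved by deleting an edge is PDBEP-feasible:
  -- an edge with both endpoints overloaded could be deleted profitably.
  deletion-maximal⇒feasible : 0ℚ < ε → ∀ {E′} →
    (∀ e → e ∈ E′ → φ G c ε (E′ ∖ e) ≤ φ G c ε E′) → PDBEP-Feasible G c E′
  deletion-maximal⇒feasible ε>0 {E′} maximal e e∈E′
    with deg G E′ (end₁ e) Nat.≤? c (end₁ e) | deg G E′ (end₂ e) Nat.≤? c (end₂ e)
  ... | yes d₁≤c₁ | _         = inj₁ d₁≤c₁
  ... | no _      | yes d₂≤c₂ = inj₂ d₂≤c₂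
  ... | no d₁≰c₁  | no d₂≰c₂  = ⊥-elim (ℚP.<-irrefl refl
          (ℚP.<-≤-trans (φ-remove ε>0 e∈E′ (ℕP.≰⇒> d₁≰c₁) (ℕP.≰⇒> d₂≰c₂)) (maximal e e∈E′)))

lemma5 : ∀ {n m : ℕ} (G : SimpleGraph n m) (c : Fin n → ℕ) (ε α : ℚ) →
    0ℚ < ε → 1ℚ ≤ α →
    (E′ : Subset m) →
    -- maximality of E′ for IP2 (z recomputed)
    (∀ e → e ∈ E′ → φ G c ε (E′ Data.Fin.Subset.- e) ≤ φ G c ε E′) →
    (∀ e → e ∉ E′ → φ G c ε (E′ ∪ ⁅ e ⁆) ≤ φ G c ε E′) →
    -- α-approximation: OPT_IP2 ≤ α · φ(E′)
    (∀ (y : Subset m) (z : Fin n → ℕ) → IP2-Feasible G c y z → φyz G ε y z ≤ α * φ G c ε E′) →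
    PDBEP-Feasible G c E′ ×
    (∀ (E″ : Subset m) → PDBEP-Optimal G c E″ →
      (1ℚ - ε) * ℕtoℚ ∣ E″ ∣ ≤ (ℕtoℚ 2 * α) * ℕtoℚ ∣ E′ ∣)
lemma5 G c ε α ε>0 α≥1 E′ deletion-maximal _ α-approximate =
  deletion-maximal⇒feasible ε>0 deletion-maximal , bound
  where
  open Excess G c
  open Objective G c ε
  ε≥0 : 0ℚ ≤ ε
  ε≥0 = ℚP.<⇒≤ ε>0
  instance
    α≥0 : ℚ.NonNegative α
    α≥0 = ℚ.nonNegative (ℚP.≤-trans (ℚP.nonNegative⁻¹ 1ℚ) α≥1)
  bound : ∀ E″ → PDBEP-Optimal G c E″ → (1ℚ - ε) * ℕtoℚ ∣ E″ ∣ ≤ (ℕtoℚ 2 * α) * ℕtoℚ ∣ E′ ∣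
  bound E″ (E″-feasible , _) = begin
    (1ℚ - ε) * ℕtoℚ ∣ E″ ∣        ≤⟨ feasible⇒φ≥ ε≥0 E″-feasible ⟩
    φ G c ε E″                    ≤⟨ α-approximate E″ (zOf G c E″) (excess-IP2-feasible E″) ⟩
    α * φ G c ε E′                ≤⟨ ℚP.*-monoˡ-≤-nonNeg α (φ≤2∣S∣ ε≥0 E′) ⟩
    α * (ℕtoℚ 2 * ℕtoℚ ∣ E′ ∣)    ≡⟨ x∙yz≈yx∙z α (ℕtoℚ 2) (ℕtoℚ ∣ E′ ∣) ⟩
    (ℕtoℚ 2 * α) * ℕtoℚ ∣ E′ ∣    ∎
    where open ℚP.≤-Reasoning
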